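{- Let $G$ be a connected block graph, $u\in V_{cut}(G)$, and $C$ an independent set of $G$ with $u\notin C$. Let $\mathcal{A}\subseteq\mathcal{B}_u(G)$ and for each $B\in\mathcal{A}$ let $Q_B$ be a $(B,u)$-independent set of $G$ that is strongly accessible from $C[B,u]$. Then $\bigcup_{B\in\mathcal{A}}Q_B\cup\bigcup_{B\in\mathcal{B}_u(G)\setminus\mathcal{A}}C[B,u]$ is an independent set of $G$ that is $(\mathcal{A},u)$-reachable from $C$.
   Context: All graphs are finite, simple and undirected. A cut-vertex of a graph is a vertex whose removal increases the number of connected components. A block of $G$ is a maximal set $S\subseteq V(G)$ such that $G[S]$ is 2-connected. A block graph is a graph every block of which induces a clique. For a connected block graph $G$: $V_{cut}(G)$ is its set of cut-vertices, $\mathcal{B}_u(G)$ the set of blocks containing $u$. For $u\in V_{cut}(G)$, $B\in\mathcal{B}_u(G)$: $G[u,B]$ is the connected component containing $u$ of $G$ minus all edges $uv$ with $v\in B$; $G[B,u]$ is the connected component containing $u$ of $G$ minus all edges $uv$ with $v\notin B$. For $p\in\{(u,B),(B,u)\}$, $u$ is the base of $p$, $G[p]$ is $G[u,B]$ resp. $G[B,u]$, and $\overline{p}$ denotes the other element of $\{(u,B),(B,u)\}$. A $p$-independent set is a subset of $V(G[p])$ independent in $G$; for any set $S$, $S[q]=S\cap V(G[q])$. Two sets $Q,Q'$ (each a $q$- or $q'$-independent set for pairs $q,q'$ with the same base $u$) are compatible if $u\in Q\iff u\in Q'$. Reachability: $I_1\rightarrow I_2$ for independent sets if $I_1=I_2$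 or $I_1\setminus I_2=\{v_1\}$, $I_2\setminus I_1=\{v_2\}$, $v_1v_2\in E(G)$. For $\mathcal{A}\subseteq\mathcal{B}_u(G)$, $C'$ is $(\mathcal{A},u)$-reachable from $C$ if there is a chain $C=C_0\rightarrow\cdots\rightarrow C_k=C'$ ($k\ge0$) of independent sets of $G$ with $C_0[X,u]=\cdots=C_k[X,u]$ for all $X\in\mathcal{B}_u(G)\setminus\mathcal{A}$; "$(B,u)$-reachable" means $(\{B\},u)$-reachable and "$(u,B)$-reachable" means $(\mathcal{B}_u(G)\setminus\{B\},u)$-reachable. Strong accessibility: for $p\in\{(u,B),(B,u)\}$, a $p$-independent set $Q'$ is strongly accessible from a $p$-independent set $Q$ if $Q'$ is compatible with $Q$ and for every $\overline{p}$-independent set $R$ compatible with $Q$, $Q\cup R$ is $p$-reachable from $Q'\cup R$. -}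

module Defs where

open import Data.Nat using (ℕ; _≤_)
open import Data.Bool using (Bool; true; false; T)
open import Data.Fin using (Fin)
open import Data.Fin.Subset using (Subset; _∈_; _∉_; _⊆_; _∪_; ∣_∣)
open import Data.Product using (Σ; ∃; _×_; _,_)
open import Data.Sum using (_⊎_)
open import Relation.Nullary using (¬_)
open import Relation.Binary.PropositionalEquality using (_≡_; _≢_)

_⟺_ : Set → Set → Set
A ⟺ B = (A → B) × (B → A)
infix 3 _⟺_

record Graph (n : ℕ) : Set where
  field
    adj    : Fin n → Fin n → Bool
    sym    : ∀ x y → adj x y ≡ adj y x
    irrefl : ∀ x → adj x x ≡ false

data Conn {n : ℕ} (E : Fin n → Fin n → Set) : Fin n → Fin n → Set where
  here  : ∀ {x} → Conn E x x
  there : ∀ {x y z} → E x y → Conn E y z → Conn E x z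

-- which of the two pairs (u,B) / (B,u) with the same base u
data Dir : Set where
  uB Bu : Dir

flipDir : Dir → Dir
flipDir uB = Bu
flipDir Bu = uB

module _ {n : ℕ} (G : Graph n) where
  open Graph G

  Adj : Fin n → Fin n → Set
  Adj x y = T (adj x y)

  Connected : Set
  Connected = ∀ x y → Conn Adj x y

  InducedConnected : (Fin n → Set) → Set
  InducedConnected P =
    ∀ x y → P x → P y → Conn (λ a b → P a × P b × Adj a b) x y

  CutVertex : Fin n → Set
  CutVertex u = Σ (Fin n) λ x → Σ (Fin n) λ y →
    x ≢ u × y ≢ u × Conn Adj x y ×
    ¬ Conn (λ a b → a ≢ u × b ≢ u × Adj a b) x y

  -- G[S] is 2-connected (biconnected convention: K2 counts)
  TwoConnected : Subset n → Set
  TwoConnected S =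
    2 ≤ ∣ S ∣ × InducedConnected (_∈ S) ×
    (∀ v → v ∈ S → InducedConnected (λ x → x ∈ S × x ≢ v))

  Block : Subset n → Set
  Block S = TwoConnected S × (∀ T → S ⊆ T → TwoConnected T → T ⊆ S)

  IsClique : Subset n → Set
  IsClique S = ∀ x y → x ∈ S → y ∈ S → x ≢ y → Adj x y

  BlockGraph : Set
  BlockGraph = ∀ S → Block S → IsClique S

  BlockAt : Fin n → Subset n → Set
  BlockAt u B = Block B × u ∈ B

  Independent : Subset n → Set
  Independent I = ∀ x y → x ∈ I → y ∈ I → ¬ Adj x y

  -- edges of G minus {uv : v ∈ B}   (for G[u,B])
  -- edges of G minus {uv : v ∉ B}   (for G[B,u])
  PairEdge : Dir → Fin n → Subset n → Fin n → Fin n → Set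
  PairEdge uB u B a b = Adj a b × ¬ ((a ≡ u × b ∈ B) ⊎ (b ≡ u × a ∈ B))
  PairEdge Bu u B a b = Adj a b × ¬ ((a ≡ u × b ∉ B) ⊎ (b ≡ u × a ∉ B))

  -- x ∈ V(G[p]) : x lies in the component of u in the edge-deleted graph
  InPart : Dir → Fin n → Subset n → Fin n → Set
  InPart d u B x = Conn (PairEdge d u B) u x

  -- T = S[p] = S ∩ V(G[p])
  IsRestr : Subset n → Dir → Fin n → Subset n → Subset n → Set
  IsRestr S d u B T = ∀ x → (x ∈ T ⟺ (x ∈ S × InPart d u B x))

  PIndep : Dir → Fin n → Subset n → Subset n → Set
  PIndep d u B Q = Independent Q × (∀ x → x ∈ Q → InPart d u B x)

  Compatible : Fin n → Subset n → Subset n → Set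
  Compatible u Q Q′ = u ∈ Q ⟺ u ∈ Q′

  -- I₁ → I₂ (token sliding step, or equality)
  Step : Subset n → Subset n → Set
  Step I₁ I₂ = I₁ ≡ I₂ ⊎
    (Σ (Fin n) λ v₁ → Σ (Fin n) λ v₂ → Adj v₁ v₂ ×
      (∀ x → ((x ∈ I₁ × x ∉ I₂) ⟺ x ≡ v₁)) ×
      (∀ x → ((x ∈ I₂ × x ∉ I₁) ⟺ x ≡ v₂)))

  AgreeOutside : Fin n → (Subset n → Set) → Subset n → Subset n → Set
  AgreeOutside u 𝒜 I J = ∀ X → BlockAt u X → ¬ 𝒜 X →
    ∀ x → InPart Bu u X x → (x ∈ I ⟺ x ∈ J)

  data Reach (u : Fin n) (𝒜 : Subset n → Set) : Subset n → Subset n → Set where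
    done : ∀ {I} → Independent I → Reach u 𝒜 I I
    step : ∀ {I J K} → Independent I → Step I J → AgreeOutside u 𝒜 I J →
           Reach u 𝒜 J K → Reach u 𝒜 I K

  -- the block family used for p-reachability
  PFamily : Dir → Fin n → Subset n → Subset n → Set
  PFamily Bu u B X = X ≡ B
  PFamily uB u B X = BlockAt u X × X ≢ B

  PReach : Dir → Fin n → Subset n → Subset n → Subset n → Set
  PReach d u B = Reach u (PFamily d u B)

  StronglyAccessible : Dir → Fin n → Subset n → Subset n → Subset n → Set
  StronglyAccessible d u B Q Q′ =
    Compatible u Q′ Q ×
    (∀ R → PIndep (flipDir d) u B R → Compatible u R Q →
       PReach d u B (Q′ ∪ R) (Q ∪ R))

-- Fix a block B ∈ 𝒜 and the current independent set I, which agrees with C on G[B,u].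
-- Since u ∉ I, I is the disjoint union of C[B,u] and the (u,B)-independent set
-- R = I ∖ V(G[B,u]), so strong accessibility slides C[B,u] ∪ R to Q_B ∪ R while
-- freezing the parts of all other blocks. For x ≠ u, membership x ∈ G[B,u] determines
-- the block B (a u-avoiding path between two neighbours of u closes a cycle through u,
-- which a maximal 2-connected set containing one of them must absorb), so these swaps do
-- not interfere and can be performed block by block. Only the blocks of 𝒜 with Q_B ≠ ∅
-- need a swap: sliding preserves the number of tokens, so Q_B = ∅ forces C[B,u] = ∅.
-- These blocks are finitely many and are read off from D, and after treating them all
-- the current set is D.

module Submission where

open import Defs
open import Data.Nat using (ℕ; _≤_; _<_)
open import Data.Bool using (T)
import Data.Bool as Bool
open import Data.Fin using (Fin)
open import Data.Fin.Properties using (_≟_)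
open import Data.Fin.Subset
  using (Subset; _∈_; _∉_; _⊆_; _⊃_; _∪_; _∩_; ∁; ⊥; ⊤; ∣_∣; Nonempty)
open import Data.Fin.Subset.Properties
  using (_∈?_; ⊆-antisym; p⊆p∪q; q⊆p∪q; x∈p∪q⁺; x∈p∪q⁻; x∈p∩q⁺; x∈p∩q⁻;
         x∈⁅y⁆⇒x≡y; ∣⁅x⁆∣≡1; p⊂q⇒∣p∣<∣q∣; ∉⊥; x∈∁p⇒x∉p; x∉p⇒x∈∁p; p∪∁p≡⊤;
         ∪-identityʳ; ∩-identityʳ; ∩-distribˡ-∪)
open import Data.Fin.Subset.Induction using (⊃-wellFounded)
open import Data.List using (List; []; _∷_; allFin; deduplicate)
open import Data.List.Membership.Propositional using () renaming (_∈_ to _∈ₗ_)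
open import Data.List.Membership.Propositional.Properties using (∈-allFin; ∈-deduplicate⁺)
open import Data.List.Relation.Unary.All using (All; []; _∷_)
open import Data.List.Relation.Unary.All.Properties using (¬Any⇒All¬)
  renaming (deduplicate⁺ to All-deduplicate⁺)
import Data.List.Relation.Unary.All as All
open import Data.List.Relation.Unary.Any using (here; there; any?)
open import Data.List.Relation.Unary.AllPairs using ([]; _∷_)
open import Data.List.Relation.Unary.Unique.Propositional using (Unique)
open import Data.List.Relation.Unary.Unique.DecPropositional.Properties using (deduplicate-!)
open import Data.Product as Product using (Σ; Σ-syntax; _×_; _,_; proj₁; proj₂)
open import Data.Sum as Sum using (_⊎_; inj₁; inj₂; [_,_]′)
open import Data.Vec using (tabulate)
open import Data.Vec.Properties using (lookup∘tabulate; lookup⇒[]=; []=⇒lookup; ≡-dec)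
open import Function using (_∘_; id)
open import Induction.WellFounded using (Acc; acc)
open import Relation.Binary.PropositionalEquality
  using (_≡_; _≢_; refl; sym; trans; subst; cong; module ≡-Reasoning)
open import Relation.Nullary using (¬_; yes; no; does; contradiction)
open import Relation.Nullary.Decidable
  using (dec-true; decidable-stable; ¬¬-excluded-middle; _⊎-dec_)
open import Relation.Unary using (Decidable)
open import Relation.Binary.Definitions using (DecidableEquality)

module _ {n : ℕ} {E : Fin n → Fin n → Set} where

  Conn-++ : ∀ {x y z} → Conn E x y → Conn E y z → Conn E x z
  Conn-++ here        q = q
  Conn-++ (there e p) q = there e (Conn-++ p q)

  Conn-reverse : (∀ {a b} → E a b → E b a) → ∀ {x y} → Conn E x y → Conn E y x
  Conn-reverse sym here        = here
  Conn-reverse sym (there e p) = Conn-++ (Conn-reverse sym p) (there (sym e) here)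

  Conn-map : ∀ {E′ : Fin n → Fin n → Set} → (∀ {a b} → E a b → E′ a b) →
             ∀ {x y} → Conn E x y → Conn E′ x y
  Conn-map f here        = here
  Conn-map f (there e p) = there (f e) (Conn-map f p)

module _ {n : ℕ} where

  x∈p∧y∈p∧x≢y⇒2≤∣p∣ : ∀ {S : Subset n} {x y} → x ∈ S → y ∈ S → x ≢ y → 2 ≤ ∣ S ∣
  x∈p∧y∈p∧x≢y⇒2≤∣p∣ {S} {x} {y} x∈S y∈S x≢y = subst (_< ∣ S ∣) (∣⁅x⁆∣≡1 x)
    (p⊂q⇒∣p∣<∣q∣ ((λ z → subst (_∈ S) (sym (x∈⁅y⁆⇒x≡y x z)) x∈S) ,
                  y , y∈S , λ z → x≢y (sym (x∈⁅y⁆⇒x≡y x z))))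

  ∈∧∉⇒≢ : ∀ {S : Subset n} {x y} → x ∈ S → y ∉ S → x ≢ y
  ∈∧∉⇒≢ x∈S y∉S refl = y∉S x∈S

module _ {n : ℕ} {P : Fin n → Set} (P? : Decidable P) where

  subsetOf : Subset n
  subsetOf = tabulate (does ∘ P?)

  ∈-subsetOf⁺ : ∀ {x} → P x → x ∈ subsetOf
  ∈-subsetOf⁺ {x} px = lookup⇒[]= x subsetOf (trans (lookup∘tabulate _ x) (dec-true (P? x) px))

  ∈-subsetOf⁻ : ∀ {x} → x ∈ subsetOf → P x
  ∈-subsetOf⁻ {x} x∈ with P? x | trans (sym (lookup∘tabulate _ x)) ([]=⇒lookup x∈)
  ... | yes px | _ = px

module _ {n : ℕ} (G : Graph n) where
  open Graph G using (irrefl) renaming (sym to adj-sym)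

  Adj-sym : ∀ {x y} → Adj G x y → Adj G y x
  Adj-sym {x} {y} = subst T (adj-sym x y)

  Adj⇒≢ : ∀ {x y} → Adj G x y → x ≢ y
  Adj⇒≢ {x} loop refl = subst T (irrefl x) loop

  InducedAdj : (Fin n → Set) → Fin n → Fin n → Set
  InducedAdj P a b = P a × P b × Adj G a b

  InducedAdj-sym : ∀ {P a b} → InducedAdj P a b → InducedAdj P b a
  InducedAdj-sym (pa , pb , e) = pb , pa , Adj-sym e

  InducedAdj-map : ∀ {P P′ : Fin n → Set} → (∀ {x} → P x → P′ x) →
                   ∀ {a b} → InducedAdj P a b → InducedAdj P′ a b
  InducedAdj-map f (pa , pb , e) = f pa , f pb , e

  InducedConn-source : ∀ {P x y} → Conn (InducedAdj P) x y → P y → P x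
  InducedConn-source here                  py = py
  InducedConn-source (there (px , _ , _) _) _ = px

  InducedConnected-hub : (P : Fin n → Set) (h : Fin n) →
    (∀ x → P x → Conn (InducedAdj P) x h) → InducedConnected G P
  InducedConnected-hub P h x⇝h x y px py =
    Conn-++ (x⇝h x px) (Conn-reverse InducedAdj-sym (x⇝h y py))

  InducedConnected-join : ∀ {P₁ P₂ P : Fin n → Set} {h} →
    InducedConnected G P₁ → InducedConnected G P₂ → P₁ h → P₂ h →
    (∀ {x} → P₁ x → P x) → (∀ {x} → P₂ x → P x) → (∀ {x} → P x → P₁ x ⊎ P₂ x) →
    InducedConnected G P
  InducedConnected-join {P = P} {h} c₁ c₂ h₁ h₂ i₁ i₂ split = InducedConnected-hub P h x⇝h
    where
    x⇝h : ∀ x → P x → Conn (InducedAdj P) x h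
    x⇝h x px with split px
    ... | inj₁ x₁ = Conn-map (InducedAdj-map i₁) (c₁ x h x₁ h₁)
    ... | inj₂ x₂ = Conn-map (InducedAdj-map i₂) (c₂ x h x₂ h₂)

  TwoConnected-minus : ∀ {S} → TwoConnected G S → ∀ v → InducedConnected G (λ x → x ∈ S × x ≢ v)
  TwoConnected-minus {S} (_ , S-conn , S-conn-minus) v with v ∈? S
  ... | yes v∈S = S-conn-minus v v∈S
  ... | no  v∉S = λ x y (x∈S , _) (y∈S , _) →
    Conn-map (InducedAdj-map (λ z∈S → z∈S , λ { refl → v∉S z∈S })) (S-conn x y x∈S y∈S)

  TwoConnected-∪ : ∀ {S₁ S₂ p q} → TwoConnected G S₁ → TwoConnected G S₂ →
    p ∈ S₁ → p ∈ S₂ → q ∈ S₁ → q ∈ S₂ → p ≢ q → TwoConnected G (S₁ ∪ S₂)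
  TwoConnected-∪ {S₁} {S₂} {p} {q} t₁ t₂ p₁ p₂ q₁ q₂ p≢q =
    x∈p∧y∈p∧x≢y⇒2≤∣p∣ (∪₁ p₁) (∪₁ q₁) p≢q ,
    InducedConnected-join (proj₁ (proj₂ t₁)) (proj₁ (proj₂ t₂)) p₁ p₂ ∪₁ ∪₂ (x∈p∪q⁻ S₁ S₂) ,
    λ v _ → minus v
    where
    ∪₁ : S₁ ⊆ S₁ ∪ S₂
    ∪₁ = p⊆p∪q S₂
    ∪₂ : S₂ ⊆ S₁ ∪ S₂
    ∪₂ = q⊆p∪q S₁ S₂
    through : ∀ v {h} → h ∈ S₁ → h ∈ S₂ → h ≢ v →
              InducedConnected G (λ x → x ∈ S₁ ∪ S₂ × x ≢ v)
    through v h₁ h₂ h≢v =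
      InducedConnected-join (TwoConnected-minus t₁ v) (TwoConnected-minus t₂ v)
        (h₁ , h≢v) (h₂ , h≢v) (λ (x₁ , x≢v) → ∪₁ x₁ , x≢v) (λ (x₂ , x≢v) → ∪₂ x₂ , x≢v)
        (λ (x∈ , x≢v) → Sum.map (_, x≢v) (_, x≢v) (x∈p∪q⁻ S₁ S₂ x∈))
    minus : ∀ v → InducedConnected G (λ x → x ∈ S₁ ∪ S₂ × x ≢ v)
    minus v with p ≟ v
    ... | yes refl = through v q₁ q₂ (p≢q ∘ sym)
    ... | no  p≢v  = through v p₁ p₂ p≢v

  infixr 5 _◅_

  data Path : Fin n → Fin n → List (Fin n) → Set where
    stop : ∀ x → Path x x (x ∷ [])
    _◅_  : ∀ {x y z vs} → Adj G x y → Path y z vs → Path x z (x ∷ vs)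

  record SimplePath (P : Fin n → Set) (a c : Fin n) : Set where
    constructor simplePath
    field
      vertices : List (Fin n)
      path     : Path a c vertices
      unique   : Unique vertices
      inside   : All P vertices

  Path-source∈ : ∀ {x c vs} → Path x c vs → x ∈ₗ vs
  Path-source∈ (stop _) = here refl
  Path-source∈ (_ ◅ _)  = here refl

  Path-target∈ : ∀ {x c vs} → Path x c vs → c ∈ₗ vs
  Path-target∈ (stop _) = here refl
  Path-target∈ (_ ◅ p)  = there (Path-target∈ p)

  Path-⇝target : ∀ {P x c vs} → Path x c vs → (∀ {w} → w ∈ₗ vs → P w) →
                 ∀ {y} → y ∈ₗ vs → Conn (InducedAdj P) y c
  Path-⇝target (stop _) _  (here refl) = here
  Path-⇝target (e ◅ p)  on (here refl) =
    there (on (here refl) , on (there (Path-source∈ p)) , e)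
          (Path-⇝target p (on ∘ there) (Path-source∈ p))
  Path-⇝target (e ◅ p)  on (there y∈) = Path-⇝target p (on ∘ there) y∈

  Path-split : ∀ {P v x c vs} → Path x c vs → Unique vs → (∀ {w} → w ∈ₗ vs → w ≢ v → P w) →
    ∀ {y} → y ∈ₗ vs → y ≢ v →
    (x ≢ v × Conn (InducedAdj P) y x) ⊎ (c ≢ v × Conn (InducedAdj P) y c)
  Path-split (stop _) _ _ (here refl) y≢v = inj₁ (y≢v , here)
  Path-split (stop _) _ _ (there ())  _
  Path-split (_ ◅ _)  _ _ (here refl) y≢v = inj₁ (y≢v , here)
  Path-split {v = v} (_◅_ {x} e p) (x∉ ∷ uniq) on (there y∈) y≢v with x ≟ v
  ... | yes refl = inj₂ (x∉ₗ (Path-target∈ p) ∘ sym ,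
                         Path-⇝target p (λ w∈ → on (there w∈) (x∉ₗ w∈ ∘ sym)) y∈)
    where x∉ₗ = All.lookup x∉
  ... | no x≢v with Path-split p uniq (on ∘ there) y∈ y≢v
  ...   | inj₂ y⇝c = inj₂ y⇝c
  ...   | inj₁ (x′≢v , y⇝x′) = inj₁ (x≢v , Conn-++ y⇝x′
          (there (on (there (Path-source∈ p)) x′≢v , on (here refl) x≢v , Adj-sym e) here))

  Path-suffix : ∀ {P y c vs a} → Path y c vs → Unique vs → All P vs → a ∈ₗ vs → SimplePath P a c
  Path-suffix p@(stop _) uniq on (here refl) = simplePath _ p uniq on
  Path-suffix p@(_ ◅ _)  uniq on (here refl) = simplePath _ p uniq on
  Path-suffix (stop _)   _    _  (there ())
  Path-suffix (_ ◅ p) (_ ∷ uniq) (_ ∷ on) (there a∈) = Path-suffix p uniq on a∈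

  loop-erasure : ∀ {P a c} → P c → Conn (InducedAdj P) a c → SimplePath P a c
  loop-erasure pc here = simplePath _ (stop _) ([] ∷ []) (pc ∷ [])
  loop-erasure {a = a} pc (there (pa , _ , e) w) with loop-erasure pc w
  ... | simplePath vs p uniq on with any? (a ≟_) vs
  ...   | yes a∈ = Path-suffix p uniq on a∈
  ...   | no  a∉ = simplePath (a ∷ vs) (e ◅ p) (¬Any⇒All¬ vs a∉ ∷ uniq) (pa ∷ on)

  -- Z = {u} ∪ π: after removing v ≠ u every vertex of π still reaches an end of π.
  cycle-TwoConnected : ∀ {u a c} → Adj G u a → Adj G u c → SimplePath (_≢ u) a c →
    Σ[ Z ∈ Subset n ] TwoConnected G Z × u ∈ Z × a ∈ Z × c ∈ Z
  cycle-TwoConnected {u} {c = c} ua uc (simplePath vs π uniq avoid) =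
    Z , (x∈p∧y∈p∧x≢y⇒2≤∣p∣ u∈Z (on-π a∈π) (Adj⇒≢ ua) , Z-conn , Z-conn-minus) ,
    u∈Z , on-π a∈π , on-π c∈π
    where
    InZ : Fin n → Set
    InZ x = x ≡ u ⊎ x ∈ₗ vs
    InZ? : Decidable InZ
    InZ? x = x ≟ u ⊎-dec any? (x ≟_) vs
    Z = subsetOf InZ?
    u∈Z = ∈-subsetOf⁺ InZ? (inj₁ refl)
    on-π : ∀ {w} → w ∈ₗ vs → w ∈ Z
    on-π = ∈-subsetOf⁺ InZ? ∘ inj₂
    a∈π = Path-source∈ π
    c∈π = Path-target∈ π
    close : ∀ {P : Fin n → Set} {w x} → P w → P u → Adj G u w →
            Conn (InducedAdj P) x w → Conn (InducedAdj P) x u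
    close pw pu uw x⇝w = Conn-++ x⇝w (there (pw , pu , Adj-sym uw) here)
    Z-conn : InducedConnected G (_∈ Z)
    Z-conn = InducedConnected-hub _ u λ x x∈Z → case (∈-subsetOf⁻ InZ? x∈Z)
      where
      case : ∀ {x} → InZ x → Conn (InducedAdj (_∈ Z)) x u
      case (inj₁ refl) = here
      case (inj₂ x∈π)  = close (on-π c∈π) u∈Z uc (Path-⇝target π on-π x∈π)
    Z-conn-minus : ∀ v → v ∈ Z → InducedConnected G (λ x → x ∈ Z × x ≢ v)
    Z-conn-minus v _ with v ≟ u
    ... | yes refl = InducedConnected-hub _ c λ x (x∈Z , x≢u) → case (∈-subsetOf⁻ InZ? x∈Z) x≢u
      where
      case : ∀ {x} → InZ x → x ≢ u → Conn (InducedAdj (λ x → x ∈ Z × x ≢ u)) x c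
      case (inj₁ refl) x≢u = contradiction refl x≢u
      case (inj₂ x∈π)  _   = Path-⇝target π (λ w∈ → on-π w∈ , All.lookup avoid w∈) x∈π
    ... | no v≢u = InducedConnected-hub _ u λ x (x∈Z , x≢v) → case (∈-subsetOf⁻ InZ? x∈Z) x≢v
      where
      u∈Z-v = u∈Z , v≢u ∘ sym
      case : ∀ {x} → InZ x → x ≢ v → Conn (InducedAdj (λ x → x ∈ Z × x ≢ v)) x u
      case (inj₁ refl) _ = here
      case (inj₂ x∈π) x≢v with Path-split π uniq (λ w∈ w≢v → on-π w∈ , w≢v) x∈π x≢v
      ... | inj₁ (a≢v , x⇝a) = close (on-π a∈π , a≢v) u∈Z-v ua x⇝a
      ... | inj₂ (c≢v , x⇝c) = close (on-π c∈π , c≢v) u∈Z-v uc x⇝c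

  TwoConnected⇒¬¬Block : ∀ {S} → TwoConnected G S → ¬ ¬ (Σ[ B ∈ Subset n ] Block G B × S ⊆ B)
  TwoConnected⇒¬¬Block {S} = extend (⊃-wellFounded S)
    where
    extend : ∀ {S} → Acc _⊃_ S → TwoConnected G S → ¬ ¬ (Σ[ B ∈ Subset n ] Block G B × S ⊆ B)
    extend {S} (acc larger) tcS k = ¬¬-excluded-middle λ where
      (yes maximal) → k (S , (tcS , maximal) , λ x∈S → x∈S)
      (no ¬maximal) → ¬maximal λ T S⊆T tcT {x} x∈T → decidable-stable (x ∈? S) λ x∉S →
        extend (larger (S⊆T , x , x∈T , x∉S)) tcT λ (B , blk , T⊆B) → k (B , blk , T⊆B ∘ S⊆T)

  Block-≡ : ∀ {B X p q} → Block G B → Block G X →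
            p ∈ B → p ∈ X → q ∈ B → q ∈ X → p ≢ q → B ≡ X
  Block-≡ {B} {X} (tcB , maxB) (tcX , maxX) p∈B p∈X q∈B q∈X p≢q = ⊆-antisym
    (λ z∈B → maxX (B ∪ X) (q⊆p∪q B X) B∪X-tc (p⊆p∪q X z∈B))
    (λ z∈X → maxB (B ∪ X) (p⊆p∪q X) B∪X-tc (q⊆p∪q B X z∈X))
    where B∪X-tc = TwoConnected-∪ tcB tcX p∈B p∈X q∈B q∈X p≢q

  last-exit : ∀ {R : Fin n → Fin n → Set} {u x} → (∀ {a b} → R a b → Adj G a b) →
    Conn R u x → x ≢ u → Σ[ v ∈ Fin n ] R u v × Conn (InducedAdj (_≢ u)) v x
  last-exit {R} {u} {x} R⇒Adj u⇝x x≢u =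
    [ (λ avoiding → contradiction refl (InducedConn-source avoiding x≢u)) , id ]′ (split u⇝x)
    where
    split : ∀ {y} → Conn R y x →
      Conn (InducedAdj (_≢ u)) y x ⊎ Σ[ v ∈ Fin n ] R u v × Conn (InducedAdj (_≢ u)) v x
    split here = inj₁ here
    split {y} (there {y = z} e z⇝x) with split z⇝x | y ≟ u
    ... | inj₂ exit   | _        = inj₂ exit
    ... | inj₁ avoids | yes refl = inj₂ (z , e , avoids)
    ... | inj₁ avoids | no  y≢u  =
      inj₁ (there (y≢u , InducedConn-source avoids x≢u , R⇒Adj e) avoids)

  -- u a ⇝ c u is a cycle, and its union with B is 2-connected.
  Block-absorbs : ∀ {u B a c} → BlockAt G u B → a ∈ B → Adj G u a → Adj G u c →
                  Conn (InducedAdj (_≢ u)) a c → c ∈ B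
  Block-absorbs ((tcB , maxB) , u∈B) a∈B ua uc a⇝c
    with cycle-TwoConnected ua uc (loop-erasure (Adj⇒≢ uc ∘ sym) a⇝c)
  ... | Z , tcZ , u∈Z , a∈Z , c∈Z =
    maxB (_ ∪ Z) (p⊆p∪q Z) (TwoConnected-∪ tcB tcZ u∈B u∈Z a∈B a∈Z (Adj⇒≢ ua)) (q⊆p∪q _ Z c∈Z)

  Enters : Dir → Subset n → Fin n → Set
  Enters uB B v = v ∉ B
  Enters Bu B v = v ∈ B

  PairEdge⇒Adj : ∀ {d u B a b} → PairEdge G d u B a b → Adj G a b
  PairEdge⇒Adj {uB} = proj₁
  PairEdge⇒Adj {Bu} = proj₁

  InPart-exit : ∀ {d u B x} → InPart G d u B x → x ≢ u →
    Σ[ v ∈ Fin n ] Adj G u v × Enters d B v × Conn (InducedAdj (_≢ u)) v x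
  InPart-exit {d} {u} {B} u⇝x x≢u with last-exit (PairEdge⇒Adj {d}) u⇝x x≢u
  ... | v , uv , v⇝x = v , PairEdge⇒Adj {d} uv , first-step d uv , v⇝x
    where
    first-step : ∀ d → PairEdge G d u B u v → Enters d B v
    first-step uB (_ , allowed) v∈B = allowed (inj₁ (refl , v∈B))
    first-step Bu (_ , allowed) = decidable-stable (v ∈? B) λ v∉B → allowed (inj₁ (refl , v∉B))

  InPart-enter : ∀ {d u B v x} → Adj G u v → Enters d B v →
                 Conn (InducedAdj (_≢ u)) v x → InPart G d u B x
  InPart-enter {d} {u} {B} {v} uv enters v⇝x =
    there (first-step d enters) (Conn-map (avoiding d) v⇝x)
    where
    first-step : ∀ d → Enters d B v → PairEdge G d u B u v
    first-step uB v∉B =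
      uv , λ { (inj₁ (_ , v∈B)) → v∉B v∈B ; (inj₂ (v≡u , _)) → Adj⇒≢ uv (sym v≡u) }
    first-step Bu v∈B =
      uv , λ { (inj₁ (_ , v∉B)) → v∉B v∈B ; (inj₂ (v≡u , _)) → Adj⇒≢ uv (sym v≡u) }
    avoiding : ∀ d {a b} → InducedAdj (_≢ u) a b → PairEdge G d u B a b
    avoiding uB (a≢u , b≢u , e) = e , λ { (inj₁ (a≡u , _)) → a≢u a≡u ; (inj₂ (b≡u , _)) → b≢u b≡u }
    avoiding Bu (a≢u , b≢u , e) = e , λ { (inj₁ (a≡u , _)) → a≢u a≡u ; (inj₂ (b≡u , _)) → b≢u b≡u }

  InPart-Bu-uB-disjoint : ∀ {u B x} → BlockAt G u B → x ≢ u →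
                          InPart G Bu u B x → ¬ InPart G uB u B x
  InPart-Bu-uB-disjoint blk x≢u inBu inuB
    with InPart-exit {Bu} inBu x≢u | InPart-exit {uB} inuB x≢u
  ... | b , ub , b∈B , b⇝x | v , uv , v∉B , v⇝x =
    v∉B (Block-absorbs blk b∈B ub uv (Conn-++ b⇝x (Conn-reverse InducedAdj-sym v⇝x)))

  InPart-Bu-injective : ∀ {u B X x} → BlockAt G u B → BlockAt G u X → x ≢ u →
                        InPart G Bu u B x → InPart G Bu u X x → B ≡ X
  InPart-Bu-injective blkB@(bB , u∈B) (bX , u∈X) x≢u inB inX
    with InPart-exit {Bu} inB x≢u | InPart-exit {Bu} inX x≢u
  ... | b , ub , b∈B , b⇝x | y , uy , y∈X , y⇝x =
    Block-≡ bB bX u∈B u∈X y∈B y∈X (Adj⇒≢ uy)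
    where y∈B = Block-absorbs blkB b∈B ub uy (Conn-++ b⇝x (Conn-reverse InducedAdj-sym y⇝x))

  module _ (conn : Connected G) {u : Fin n} where

    InPart-Bu⊎uB : ∀ B x → InPart G Bu u B x ⊎ InPart G uB u B x
    InPart-Bu⊎uB B x with x ≟ u
    ... | yes refl = inj₁ here
    ... | no  x≢u with last-exit id (conn u x) x≢u
    ...   | v , uv , v⇝x with v ∈? B
    ...     | yes v∈B = inj₁ (InPart-enter {Bu} uv v∈B v⇝x)
    ...     | no  v∉B = inj₂ (InPart-enter {uB} uv v∉B v⇝x)

    InPart-Bu? : ∀ {B} → BlockAt G u B → Decidable (InPart G Bu u B)
    InPart-Bu? {B} blk x with InPart-Bu⊎uB B x | x ≟ u
    ... | inj₁ inBu | _        = yes inBu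
    ... | inj₂ _    | yes refl = yes here
    ... | inj₂ inuB | no  x≢u  = no λ inBu → InPart-Bu-uB-disjoint blk x≢u inBu inuB

    ¬InPart-Bu⇒InPart-uB : ∀ {B x} → ¬ InPart G Bu u B x → InPart G uB u B x
    ¬InPart-Bu⇒InPart-uB {B} {x} ¬inBu =
      [ (λ inBu → contradiction inBu ¬inBu) , id ]′ (InPart-Bu⊎uB B x)

    -- The edge uv is 2-connected, as a degenerate cycle through u.
    InPart-Bu-¬¬covers : ∀ {x} → x ≢ u → ¬ ¬ (Σ[ X ∈ Subset n ] BlockAt G u X × InPart G Bu u X x)
    InPart-Bu-¬¬covers {x} x≢u k with last-exit id (conn u x) x≢u
    ... | v , uv , v⇝x with cycle-TwoConnected uv uv (loop-erasure (Adj⇒≢ uv ∘ sym) here)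
    ...   | Z , tcZ , u∈Z , v∈Z , _ = TwoConnected⇒¬¬Block tcZ λ (X , blk , Z⊆X) →
            k (X , (blk , Z⊆X u∈Z) , InPart-enter {Bu} uv (Z⊆X v∈Z) v⇝x)

  Step-sym : ∀ {I J} → Step G I J → Step G J I
  Step-sym (inj₁ I≡J)                            = inj₁ (sym I≡J)
  Step-sym (inj₂ (v₁ , v₂ , e , left , entered)) = inj₂ (v₂ , v₁ , Adj-sym e , entered , left)

  module _ {u : Fin n} {𝒜 : Subset n → Set} where

    Reach-independentˡ : ∀ {I J} → Reach G u 𝒜 I J → Independent G I
    Reach-independentˡ (done indI)       = indI
    Reach-independentˡ (step indI _ _ _) = indI

    Reach-independentʳ : ∀ {I J} → Reach G u 𝒜 I J → Independent G J
    Reach-independentʳ (done indI)      = indI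
    Reach-independentʳ (step _ _ _ J⇝K) = Reach-independentʳ J⇝K

    Reach-++ : ∀ {I J K} → Reach G u 𝒜 I J → Reach G u 𝒜 J K → Reach G u 𝒜 I K
    Reach-++ (done _)              J⇝K = J⇝K
    Reach-++ (step indI s agree r) J⇝K = step indI s agree (Reach-++ r J⇝K)

    Reach-reverse : ∀ {I J} → Reach G u 𝒜 I J → Reach G u 𝒜 J I
    Reach-reverse (done indI) = done indI
    Reach-reverse (step indI s agree r) = Reach-++ (Reach-reverse r)
      (step (Reach-independentˡ r) (Step-sym s)
            (λ X blk X∉𝒜 x inX → Product.swap (agree X blk X∉𝒜 x inX)) (done indI))

    Reach-nonempty : ∀ {I J} → Reach G u 𝒜 I J → Nonempty J → Nonempty I
    Reach-nonempty (done _)                     J≠∅ = J≠∅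
    Reach-nonempty (step _ (inj₁ refl) _ r)     J≠∅ = Reach-nonempty r J≠∅
    Reach-nonempty (step _ (inj₂ (v₁ , _ , _ , left , _)) _ _) _ = v₁ , proj₁ (proj₂ (left v₁) refl)

  Reach-mono : ∀ {u} {𝒜 𝒜′ : Subset n → Set} → (∀ {X} → 𝒜 X → 𝒜′ X) →
               ∀ {I J} → Reach G u 𝒜 I J → Reach G u 𝒜′ I J
  Reach-mono 𝒜⊆𝒜′ (done indI) = done indI
  Reach-mono 𝒜⊆𝒜′ (step indI s agree r) =
    step indI s (λ X blk X∉𝒜′ → agree X blk (X∉𝒜′ ∘ 𝒜⊆𝒜′)) (Reach-mono 𝒜⊆𝒜′ r)

module Swapping {n : ℕ} (G : Graph n) (conn : Connected G) (u : Fin n)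
  (C : Subset n) (u∉C : u ∉ C)
  (𝒜 : Subset n → Set) (𝒜⇒BlockAt : ∀ B → 𝒜 B → BlockAt G u B)
  (Q : Subset n → Subset n)
  (Q-spec : ∀ B → 𝒜 B →
    PIndep G Bu u B (Q B) ×
    (∀ T → IsRestr G C Bu u B T → StronglyAccessible G Bu u B T (Q B)))
  where

  part : ∀ {B} → 𝒜 B → Subset n
  part aB = subsetOf (InPart-Bu? G conn (𝒜⇒BlockAt _ aB))

  ∈-part⁺ : ∀ {B} (aB : 𝒜 B) {x} → InPart G Bu u B x → x ∈ part aB
  ∈-part⁺ aB = ∈-subsetOf⁺ (InPart-Bu? G conn (𝒜⇒BlockAt _ aB))

  ∈-part⁻ : ∀ {B} (aB : 𝒜 B) {x} → x ∈ part aB → InPart G Bu u B x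
  ∈-part⁻ aB = ∈-subsetOf⁻ (InPart-Bu? G conn (𝒜⇒BlockAt _ aB))

  C∩part-restricts : ∀ {B} (aB : 𝒜 B) → IsRestr G C Bu u B (C ∩ part aB)
  C∩part-restricts aB x =
    (λ x∈ → Product.map₂ (∈-part⁻ aB) (x∈p∩q⁻ C (part aB) x∈)) ,
    (λ (x∈C , inB) → x∈p∩q⁺ (x∈C , ∈-part⁺ aB inB))

  Q-accessible : ∀ {B} (aB : 𝒜 B) → StronglyAccessible G Bu u B (C ∩ part aB) (Q B)
  Q-accessible aB = proj₂ (Q-spec _ aB) _ (C∩part-restricts aB)

  Compatible-C∩part : ∀ {B} (aB : 𝒜 B) {R} → u ∉ R → Compatible G u R (C ∩ part aB)
  Compatible-C∩part aB u∉R =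
    (λ u∈R → contradiction u∈R u∉R) ,
    (λ u∈C∩P → contradiction (proj₁ (x∈p∩q⁻ C (part aB) u∈C∩P)) u∉C)

  u∉Q : ∀ {B} → 𝒜 B → u ∉ Q B
  u∉Q aB u∈Q = u∉C (proj₁ (x∈p∩q⁻ C (part aB) (proj₁ (proj₁ (Q-accessible aB)) u∈Q)))

  Q⊆InPart-Bu : ∀ {B} → 𝒜 B → ∀ {x} → x ∈ Q B → InPart G Bu u B x
  Q⊆InPart-Bu aB = proj₂ (proj₁ (Q-spec _ aB)) _

  Q-InPart-Bu-injective : ∀ {B X x} → 𝒜 B → BlockAt G u X → x ∈ Q B → InPart G Bu u X x → B ≡ X
  Q-InPart-Bu-injective aB blkX x∈Q inX =
    InPart-Bu-injective G (𝒜⇒BlockAt _ aB) blkX (∈∧∉⇒≢ x∈Q (u∉Q aB)) (Q⊆InPart-Bu aB x∈Q) inX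

  Q-nonempty : ∀ {B x} → 𝒜 B → x ∈ C → InPart G Bu u B x → Nonempty (Q B)
  Q-nonempty {B} {x} aB x∈C inB = subst Nonempty (∪-identityʳ (Q B))
    (Reach-nonempty G (proj₂ (Q-accessible aB) ⊥ ∅-independent (Compatible-C∩part aB ∉⊥))
                      (x , subst (x ∈_) (sym (∪-identityʳ _)) (x∈p∩q⁺ (x∈C , ∈-part⁺ aB inB))))
    where
    ∅-independent : PIndep G uB u B ⊥
    ∅-independent = (λ _ _ x∈∅ _ → contradiction x∈∅ ∉⊥) , (λ _ x∈∅ → contradiction x∈∅ ∉⊥)

  swap-reach : ∀ {B} (aB : 𝒜 B) {I} → Independent G I → u ∉ I → I ∩ part aB ≡ C ∩ part aB →
               Reach G u 𝒜 I (Q B ∪ (I ∩ ∁ (part aB)))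
  swap-reach {B} aB {I} indI u∉I I∩P≡C∩P =
    subst (λ S → Reach G u 𝒜 S (Q B ∪ R)) T∪R≡I
      (Reach-mono G (λ { refl → aB }) (Reach-reverse G Q∪R⇝T∪R))
    where
    open ≡-Reasoning
    P = part aB
    R = I ∩ ∁ P
    R⊆I : R ⊆ I
    R⊆I = proj₁ ∘ x∈p∩q⁻ I (∁ P)
    R-independent : PIndep G uB u B R
    R-independent =
      (λ x y x∈R y∈R → indI x y (R⊆I x∈R) (R⊆I y∈R)) ,
      (λ x x∈R → ¬InPart-Bu⇒InPart-uB G conn
         (x∈∁p⇒x∉p (proj₂ (x∈p∩q⁻ I (∁ P) x∈R)) ∘ ∈-part⁺ aB))
    Q∪R⇝T∪R : PReach G Bu u B (Q B ∪ R) ((C ∩ P) ∪ R)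
    Q∪R⇝T∪R = proj₂ (Q-accessible aB) R R-independent (Compatible-C∩part aB (u∉I ∘ R⊆I))
    T∪R≡I : (C ∩ P) ∪ R ≡ I
    T∪R≡I = begin
      (C ∩ P) ∪ (I ∩ ∁ P)  ≡⟨ cong (_∪ R) I∩P≡C∩P ⟨
      (I ∩ P) ∪ (I ∩ ∁ P)  ≡⟨ ∩-distribˡ-∪ I P (∁ P) ⟨
      I ∩ (P ∪ ∁ P)        ≡⟨ cong (I ∩_) (p∪∁p≡⊤ P) ⟩
      I ∩ ⊤                ≡⟨ ∩-identityʳ I ⟩
      I                    ∎

  swapIn : ∀ {L} → All 𝒜 L → Subset n
  swapIn []                = C
  swapIn {B ∷ _} (aB ∷ aL) = Q B ∪ (swapIn aL ∩ ∁ (part aB))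

  ∈-swapIn⁻ : ∀ {L} (aL : All 𝒜 L) {x} → x ∈ swapIn aL →
    (Σ[ B ∈ Subset n ] B ∈ₗ L × x ∈ Q B) ⊎ (x ∈ C × ∀ {B} → B ∈ₗ L → ¬ InPart G Bu u B x)
  ∈-swapIn⁻ [] x∈C = inj₂ (x∈C , λ ())
  ∈-swapIn⁻ {B ∷ _} (aB ∷ aL) x∈ with x∈p∪q⁻ (Q B) _ x∈
  ... | inj₁ x∈Q  = inj₁ (B , here refl , x∈Q)
  ... | inj₂ x∈S∖P with x∈p∩q⁻ (swapIn aL) _ x∈S∖P
  ...   | x∈S , x∉P with ∈-swapIn⁻ aL x∈S
  ...     | inj₁ (B′ , B′∈L , x∈Q) = inj₁ (B′ , there B′∈L , x∈Q)
  ...     | inj₂ (x∈C , outside)   = inj₂ (x∈C , λ where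
              (here refl) → x∈∁p⇒x∉p x∉P ∘ ∈-part⁺ aB
              (there B′∈L) → outside B′∈L)

  ∈-swapIn⁺-C : ∀ {L} (aL : All 𝒜 L) {x} → x ∈ C →
    (∀ {B} → B ∈ₗ L → ¬ InPart G Bu u B x) → x ∈ swapIn aL
  ∈-swapIn⁺-C []        x∈C _       = x∈C
  ∈-swapIn⁺-C (aB ∷ aL) x∈C outside = x∈p∪q⁺ (inj₂ (x∈p∩q⁺
    (∈-swapIn⁺-C aL x∈C (outside ∘ there) , x∉p⇒x∈∁p (outside (here refl) ∘ ∈-part⁻ aB))))

  ∈-swapIn⁺-Q : ∀ {L} (aL : All 𝒜 L) → Unique L → ∀ {B x} → B ∈ₗ L → x ∈ Q B → x ∈ swapIn aL
  ∈-swapIn⁺-Q (_ ∷ _) _ (here refl) x∈Q = x∈p∪q⁺ (inj₁ x∈Q)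
  ∈-swapIn⁺-Q (aB′ ∷ aL) (B′∉L ∷ uniq) (there B∈L) x∈Q = x∈p∪q⁺ (inj₂ (x∈p∩q⁺
    (∈-swapIn⁺-Q aL uniq B∈L x∈Q , x∉p⇒x∈∁p λ x∈P′ →
      All.lookup B′∉L B∈L (sym (Q-InPart-Bu-injective (All.lookup aL B∈L) (𝒜⇒BlockAt _ aB′)
                                                      x∈Q (∈-part⁻ aB′ x∈P′))))))

  u∉swapIn : ∀ {L} (aL : All 𝒜 L) → u ∉ swapIn aL
  u∉swapIn aL u∈ with ∈-swapIn⁻ aL u∈
  ... | inj₁ (B , B∈L , u∈Q) = u∉Q (All.lookup aL B∈L) u∈Q
  ... | inj₂ (u∈C , _)       = u∉C u∈C

  swapIn-agrees : ∀ {L} (aL : All 𝒜 L) {B} → All (B ≢_) L → (aB : 𝒜 B) →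
                  swapIn aL ∩ part aB ≡ C ∩ part aB
  swapIn-agrees aL {B} B∉L aB = ⊆-antisym S∩P⊆C∩P C∩P⊆S∩P
    where
    P = part aB
    S∩P⊆C∩P : swapIn aL ∩ P ⊆ C ∩ P
    S∩P⊆C∩P x∈ with x∈p∩q⁻ (swapIn aL) P x∈
    ... | x∈S , x∈P with ∈-swapIn⁻ aL x∈S
    ...   | inj₂ (x∈C , _) = x∈p∩q⁺ (x∈C , x∈P)
    ...   | inj₁ (B′ , B′∈L , x∈Q) = contradiction
            (Q-InPart-Bu-injective (All.lookup aL B′∈L) (𝒜⇒BlockAt _ aB) x∈Q (∈-part⁻ aB x∈P))
            (All.lookup B∉L B′∈L ∘ sym)
    C∩P⊆S∩P : C ∩ P ⊆ swapIn aL ∩ P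
    C∩P⊆S∩P x∈ with x∈p∩q⁻ C P x∈
    ... | x∈C , x∈P = x∈p∩q⁺ (∈-swapIn⁺-C aL x∈C (λ B′∈L inB′ → All.lookup B∉L B′∈L
            (InPart-Bu-injective G (𝒜⇒BlockAt _ aB) (𝒜⇒BlockAt _ (All.lookup aL B′∈L))
               (∈∧∉⇒≢ x∈C u∉C) (∈-part⁻ aB x∈P) inB′)) , x∈P)

  reach-swapIn : Independent G C → ∀ {L} (aL : All 𝒜 L) → Unique L → Reach G u 𝒜 C (swapIn aL)
  reach-swapIn indC []        _             = done indC
  reach-swapIn indC (aB ∷ aL) (B∉L ∷ uniq) = Reach-++ G C⇝S
    (swap-reach aB (Reach-independentʳ G C⇝S) (u∉swapIn aL) (swapIn-agrees aL B∉L aB))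
    where C⇝S = reach-swapIn indC aL uniq

  Covers : List (Subset n) → Set
  Covers L = ∀ {B y} → 𝒜 B → y ∈ Q B → B ∈ₗ L

  record CoveringList : Set where
    field
      blocks  : List (Subset n)
      all-𝒜   : All 𝒜 blocks
      unique  : Unique blocks
      covers  : Covers blocks

  module _ (D : Subset n)
    (D-spec : ∀ x → (x ∈ D ⟺
      ((Σ (Subset n) λ B → 𝒜 B × x ∈ Q B) ⊎
       (Σ (Subset n) λ B → BlockAt G u B × ¬ 𝒜 B × x ∈ C × InPart G Bu u B x))))
    where

    Q-owner? : ∀ y → (Σ[ B ∈ Subset n ] 𝒜 B × y ∈ Q B) ⊎ (∀ {B} → 𝒜 B → y ∉ Q B)
    Q-owner? y with y ∈? D
    ... | no y∉D = inj₂ λ aB y∈Q → y∉D (proj₂ (D-spec y) (inj₁ (_ , aB , y∈Q)))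
    ... | yes y∈D with proj₁ (D-spec y) y∈D
    ...   | inj₁ owner = inj₁ owner
    ...   | inj₂ (X , blkX , X∉𝒜 , _ , inX) =
            inj₂ λ aB y∈Q → X∉𝒜 (subst 𝒜 (Q-InPart-Bu-injective aB blkX y∈Q inX) aB)

    owners : (ys : List (Fin n)) → Σ[ L ∈ List (Subset n) ] All 𝒜 L ×
             (∀ {B y} → 𝒜 B → y ∈ₗ ys → y ∈ Q B → B ∈ₗ L)
    owners [] = [] , [] , λ _ ()
    owners (y ∷ ys) with owners ys | Q-owner? y
    ... | L , aL , covers | inj₂ unowned = L , aL , λ where
          aB (here refl) y∈Q  → contradiction y∈Q (unowned aB)
          aB (there y∈ys) y∈Q → covers aB y∈ys y∈Q
    ... | L , aL , covers | inj₁ (B′ , aB′ , y∈Q′) = B′ ∷ L , aB′ ∷ aL , λ where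
          aB (here refl) y∈Q  →
            here (Q-InPart-Bu-injective aB (𝒜⇒BlockAt _ aB′) y∈Q (Q⊆InPart-Bu aB′ y∈Q′))
          aB (there y∈ys) y∈Q → there (covers aB y∈ys y∈Q)

    covering : CoveringList
    covering with owners (allFin n)
    ... | L , aL , covers = record
      { blocks = deduplicate _≟ₛ_ L
      ; all-𝒜  = All-deduplicate⁺ _≟ₛ_ aL
      ; unique = deduplicate-! _≟ₛ_ L
      ; covers = λ aB y∈Q → ∈-deduplicate⁺ _≟ₛ_ (covers aB (∈-allFin _) y∈Q)
      }
      where
      _≟ₛ_ : DecidableEquality (Subset n)
      _≟ₛ_ = ≡-dec Bool._≟_

    swapIn≡D : ∀ {L} (aL : All 𝒜 L) → Unique L → Covers L → swapIn aL ≡ D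
    swapIn≡D aL uniq covers = ⊆-antisym S⊆D D⊆S
      where
      D⊆S : D ⊆ swapIn aL
      D⊆S {x} x∈D with proj₁ (D-spec x) x∈D
      ... | inj₁ (B , aB , x∈Q) = ∈-swapIn⁺-Q aL uniq (covers aB x∈Q) x∈Q
      ... | inj₂ (X , blkX , X∉𝒜 , x∈C , inX) = ∈-swapIn⁺-C aL x∈C λ B∈L inB →
            let aB = All.lookup aL B∈L in
            X∉𝒜 (subst 𝒜 (InPart-Bu-injective G (𝒜⇒BlockAt _ aB) blkX (∈∧∉⇒≢ x∈C u∉C) inB inX) aB)
      -- A vertex of C outside every listed part lies in G[X,u] for some X ∉ 𝒜:
      -- for X ∈ 𝒜, Q X would be nonempty and X would be listed.
      S⊆D : swapIn aL ⊆ D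
      S⊆D {x} x∈S with ∈-swapIn⁻ aL x∈S
      ... | inj₁ (B , B∈L , x∈Q) = proj₂ (D-spec x) (inj₁ (B , All.lookup aL B∈L , x∈Q))
      ... | inj₂ (x∈C , outside) = decidable-stable (x ∈? D) λ x∉D →
            InPart-Bu-¬¬covers G conn (∈∧∉⇒≢ x∈C u∉C) λ (X , blkX , inX) →
            ¬¬-excluded-middle λ where
              (no X∉𝒜) → x∉D (proj₂ (D-spec x) (inj₂ (X , blkX , X∉𝒜 , x∈C , inX)))
              (yes aX) → outside (covers aX (proj₂ (Q-nonempty aX x∈C inX))) inX

lemma4p2 : (n : ℕ) (G : Graph n) → Connected G → BlockGraph G →
    (u : Fin n) → CutVertex G u →
    (C : Subset n) → Independent G C → u ∉ C →
    (𝒜 : Subset n → Set) → (∀ B → 𝒜 B → BlockAt G u B) →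
    (Q : Subset n → Subset n) →
    (∀ B → 𝒜 B →
      PIndep G Bu u B (Q B) ×
      (∀ T → IsRestr G C Bu u B T → StronglyAccessible G Bu u B T (Q B))) →
    (D : Subset n) →
    (∀ x → (x ∈ D ⟺
      ((Σ (Subset n) λ B → 𝒜 B × x ∈ Q B) ⊎
       (Σ (Subset n) λ B → BlockAt G u B × ¬ 𝒜 B × x ∈ C × InPart G Bu u B x)))) →
    Independent G D × Reach G u 𝒜 C D
lemma4p2 _ G conn _ u _ C indC u∉C 𝒜 𝒜⇒BlockAt Q Q-spec D D-spec =
  subst (Independent G) S≡D (Reach-independentʳ G C⇝S) , subst (Reach G u 𝒜 C) S≡D C⇝S
  where
  open Swapping G conn u C u∉C 𝒜 𝒜⇒BlockAt Q Q-spec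
  open CoveringList (covering D D-spec)
  C⇝S = reach-swapIn indC all-𝒜 unique
  S≡D = swapIn≡D D D-spec all-𝒜 unique covers
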